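{- Let $T$ be a tree. Then $\phi(K_1\nabla T)=\lfloor v(T)/2\rfloor$.
   Context: $v(T)$ is the number of vertices of $T$; $K_1\nabla T$ is obtained from $T$ by adding a new vertex adjacent to all vertices of $T$; $\phi(G)$ denotes the maximum number of pairwise edge-disjoint cycles in $G$. -}

module Defs where

open import Data.Nat using (ℕ; zero; suc; _+_; _≤_; _/_)
open import Data.Nat.DivMod using (_mod_)
open import Data.Fin using (Fin; toℕ) renaming (zero to fzero; suc to fsuc)
open import Data.Bool using (Bool; true; false)
open import Data.Product using (Σ; _×_; _,_)
open import Data.Sum using (_⊎_)
open import Relation.Binary.PropositionalEquality using (_≡_; _≢_)
open import Relation.Nullary using (¬_)
open import Function.Definitions using (Injective)

record Graph (n : ℕ) : Set where
  field
    adj     : Fin n → Fin n → Bool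
    adj-sym : ∀ u v → adj u v ≡ adj v u
    loopless : ∀ u → adj u u ≡ false
open Graph public

Adj : ∀ {n} → Graph n → Fin n → Fin n → Set
Adj G u v = adj G u v ≡ true

data Walk {n : ℕ} (G : Graph n) : Fin n → Fin n → Set where
  []  : ∀ {u} → Walk G u u
  _∷_ : ∀ {u v w} → Adj G u v → Walk G v w → Walk G u w

Connected : ∀ {n} → Graph n → Set
Connected G = ∀ u v → Walk G u v

next : ∀ {k} → Fin (suc k) → Fin (suc k)
next {k} i = (suc (toℕ i)) mod (suc k)

record Cycle {n : ℕ} (G : Graph n) : Set where
  field
    j      : ℕ
    vert   : Fin (3 + j) → Fin n
    vert-injective : Injective _≡_ _≡_ vert
    vert-adj : ∀ i → Adj G (vert i) (vert (next i))
open Cycle public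

len : ∀ {n} {G : Graph n} → Cycle G → ℕ
len C = 3 + j C

edge : ∀ {n} {G : Graph n} (C : Cycle G) → Fin (3 + j C) → Fin n × Fin n
edge C i = vert C i , vert C (next i)

SameEdge : ∀ {n} → Fin n × Fin n → Fin n × Fin n → Set
SameEdge (a , b) (c , d) = (a ≡ c × b ≡ d) ⊎ (a ≡ d × b ≡ c)

EdgeDisjoint : ∀ {n} {G : Graph n} → Cycle G → Cycle G → Set
EdgeDisjoint C D = ∀ i i' → ¬ SameEdge (edge C i) (edge D i')

Acyclic : ∀ {n} → Graph n → Set
Acyclic G = ¬ Cycle G

IsTree : ∀ {n} → Graph n → Set
IsTree G = Connected G × Acyclic G

CyclePacking : ∀ {n} → Graph n → ℕ → Set
CyclePacking G m = Σ (Fin m → Cycle G) λ Cs → ∀ a b → a ≢ b → EdgeDisjoint (Cs a) (Cs b)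

IsMaxCyclePackingNumber : ∀ {n} → Graph n → ℕ → Set
IsMaxCyclePackingNumber G k = CyclePacking G k × (∀ m → CyclePacking G m → m ≤ k)

joinK1-adj : ∀ {n} → Graph n → Fin (suc n) → Fin (suc n) → Bool
joinK1-adj T fzero    fzero    = false
joinK1-adj T fzero    (fsuc v) = true
joinK1-adj T (fsuc u) fzero    = true
joinK1-adj T (fsuc u) (fsuc v) = adj T u v

joinK1-sym : ∀ {n} (T : Graph n) u v → joinK1-adj T u v ≡ joinK1-adj T v u
joinK1-sym T fzero    fzero    = _≡_.refl
joinK1-sym T fzero    (fsuc v) = _≡_.refl
joinK1-sym T (fsuc u) fzero    = _≡_.refl
joinK1-sym T (fsuc u) (fsuc v) = adj-sym T u v

joinK1-loopless : ∀ {n} (T : Graph n) u → joinK1-adj T u u ≡ false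
joinK1-loopless T fzero    = _≡_.refl
joinK1-loopless T (fsuc u) = loopless T u

K1∇ : ∀ {n} → Graph n → Graph (suc n)
K1∇ T = record { adj = joinK1-adj T ; adj-sym = joinK1-sym T ; loopless = joinK1-loopless T }

module Submission where

-- As T is acyclic, every cycle of K₁ ∇ T passes through the apex, reaching it from one vertex of
-- T and leaving it to another; in a packing these 2m vertices are pairwise distinct, so 2m ≤ v(T).
-- Conversely, root T and pair off its vertices greedily, children before parents: a vertex is
-- matched with a waiting child (a path of length 1), else with a waiting sibling through their
-- common parent (a path of length 2), else it waits itself. No two waiting vertices share a parent,
-- so at the end at most one child of the root waits, and it is matched with the root. A matched
-- path closed up through the apex is a cycle, and these cycles are edge-disjoint because no vertex
-- of a later path is an end of an earlier one.

open import Defs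
open import Data.Nat using (ℕ; zero; suc; _+_; _*_; _≤_; _%_; _/_; s≤s; s≤s⁻¹)
open import Data.Nat.Properties using (≤-trans; ≤-reflexive; +-identityʳ; +-suc; +-comm; *-comm; n≤1+n; m≤m+n; m≢1+n+m; 1+n≢n; module ≤-Reasoning)
open import Data.Nat.DivMod using (m<n⇒m%n≡m; n%n≡0; m*n/n≡m; /-monoˡ-≤; m<n*o⇒m/o<n)
open import Data.Nat.Tactic.RingSolver using (solve-∀)
open import Data.Fin using (Fin; toℕ; fromℕ; inject₁; inject≤; punchOut; splitAt; join) renaming (zero to fzero; suc to fsuc)
import Data.Fin.Properties as Fin
import Data.Vec.Functional as Vector
open import Data.Vec using (Vec; []; _∷_; lookup)
open import Data.Vec.Relation.Unary.All using ([]; _∷_)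
open import Data.Vec.Relation.Unary.AllPairs using ([]; _∷_)
open import Data.Vec.Relation.Unary.Unique.Propositional using (Unique)
open import Data.Vec.Relation.Unary.Unique.Propositional.Properties using (lookup-injective)
open import Data.Product using (∃; ∃₂; _×_; _,_; proj₁; proj₂; uncurry)
open import Data.Sum using (_⊎_; inj₁; inj₂; map₂)
open import Data.List using (List; []; _∷_; [_]; length)
open import Data.List.Relation.Unary.Any as Any using (here; there)
open import Data.List.Relation.Unary.Any.Properties using (lookup-index)
open import Data.List.Relation.Unary.All as All using (All; []; _∷_)
open import Data.List.Relation.Unary.AllPairs as AllPairs using (AllPairs; []; _∷_)
open import Data.List.Membership.Propositional using (_∈_; _∉_)
open import Data.List.Relation.Binary.Permutation.Propositional using (_↭_; ↭-refl; ↭-prep; ↭-swap; ↭-trans; ↭⇒↭ₛ)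
open import Data.List.Relation.Binary.Permutation.Propositional.Properties using (All-resp-↭; ↭-length)
import Data.List.Relation.Binary.Permutation.Setoid.Properties as Permutationₛ
open import Function using (_∘_)
open import Relation.Binary.PropositionalEquality hiding ([_])
open import Relation.Nullary using (¬_; yes; no; contradiction)
open import Relation.Nullary.Decidable using (decidable-stable)
open import Relation.Unary using (Decidable)

data LastView : ∀ {k} → Fin (suc k) → Set where
  last  : ∀ {k} → LastView (fromℕ k)
  inner : ∀ {k} (i : Fin k) → LastView (inject₁ i)

lastView : ∀ {k} (i : Fin (suc k)) → LastView i
lastView {zero}  fzero    = last
lastView {suc k} fzero    = inner fzero
lastView {suc k} (fsuc i) with lastView i
... | last    = last
... | inner j = inner (fsuc j)

next-fromℕ : ∀ k → next (fromℕ k) ≡ fzero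
next-fromℕ k = Fin.toℕ-injective (begin
  toℕ (next (fromℕ k))          ≡⟨ Fin.toℕ-fromℕ< _ ⟩
  suc (toℕ (fromℕ k)) % suc k   ≡⟨ cong (λ t → suc t % suc k) (Fin.toℕ-fromℕ k) ⟩
  suc k % suc k                 ≡⟨ n%n≡0 (suc k) ⟩
  0                             ∎)
  where open ≡-Reasoning

next-inject₁ : ∀ {k} (i : Fin k) → next (inject₁ i) ≡ fsuc i
next-inject₁ {k} i = Fin.toℕ-injective (begin
  toℕ (next (inject₁ i))          ≡⟨ Fin.toℕ-fromℕ< _ ⟩
  suc (toℕ (inject₁ i)) % suc k   ≡⟨ cong (λ t → suc t % suc k) (Fin.toℕ-inject₁ i) ⟩
  suc (toℕ i) % suc k             ≡⟨ m<n⇒m%n≡m (s≤s (Fin.toℕ<n i)) ⟩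
  suc (toℕ i)                     ∎)
  where open ≡-Reasoning

next-surjective : ∀ {k} (i : Fin (suc k)) → ∃ λ p → next p ≡ i
next-surjective {k}     fzero    = fromℕ k , next-fromℕ k
next-surjective {suc k} (fsuc i) = inject₁ i , next-inject₁ i

next≢id : ∀ {k} (i : Fin (2 + k)) → next i ≢ i
next≢id i with lastView i
... | last    = λ e → Fin.0≢1+n (trans (sym (next-fromℕ _)) e)
... | inner j = λ e → 1+n≢n (trans (cong toℕ (trans (sym (next-inject₁ j)) e)) (Fin.toℕ-inject₁ j))

next²≢id : ∀ {k} (i : Fin (3 + k)) → next (next i) ≢ i
next²≢id i with lastView i
... | last = λ e → Fin.0≢1+n (Fin.suc-injective (trans (sym (cong next (next-fromℕ _))) e))
... | inner j with lastView j
...   | last    = λ e → Fin.0≢1+n (trans (sym (trans (cong next (next-inject₁ j)) (next-fromℕ _))) e)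
...   | inner l = λ e → m≢1+n+m (toℕ l) (sym (begin
  suc (suc (toℕ l))                        ≡⟨ cong toℕ (sym (trans (cong next (next-inject₁ (inject₁ l))) (next-inject₁ (fsuc l)))) ⟩
  toℕ (next (next (inject₁ (inject₁ l))))  ≡⟨ cong toℕ e ⟩
  toℕ (inject₁ (inject₁ l))                ≡⟨ trans (Fin.toℕ-inject₁ (inject₁ l)) (Fin.toℕ-inject₁ l) ⟩
  toℕ l                                    ∎))
  where open ≡-Reasoning

pick : ∀ {A : Set} {P : A → Set} → Decidable P → (xs : List A) →
       All (¬_ ∘ P) xs ⊎ ∃₂ λ x ys → P x × xs ↭ x ∷ ys
pick P? [] = inj₁ []
pick P? (x ∷ xs) with P? x
... | yes px = inj₂ (x , xs , px , ↭-refl)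
... | no ¬px with pick P? xs
...   | inj₁ none                = inj₁ (¬px ∷ none)
...   | inj₂ (y , ys , py , σ)   = inj₂ (y , x ∷ ys , py , ↭-trans (↭-prep x σ) (↭-swap x y ↭-refl))

complete⇒≤length : ∀ {n} (xs : List (Fin n)) → (∀ v → v ∈ xs) → n ≤ length xs
complete⇒≤length xs complete = Fin.injective⇒≤ index-injective
  where
    index-injective : ∀ {v w} → Any.index (complete v) ≡ Any.index (complete w) → v ≡ w
    index-injective {v} {w} eq =
      trans (lookup-index (complete v)) (trans (cong (Data.List.lookup xs) eq) (sym (lookup-index (complete w))))

splitAt-injective : ∀ m {n} {i j : Fin (m + n)} → splitAt m i ≡ splitAt m j → i ≡ j
splitAt-injective m {n} {i} {j} e =
  trans (sym (Fin.join-splitAt m n i)) (trans (cong (join m n) e) (Fin.join-splitAt m n j))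

Pairwise : ∀ {A : Set} {m} → (A → A → Set) → (Fin m → A) → Set
Pairwise R xs = ∀ a b → a ≢ b → R (xs a) (xs b)

pairwise-∷ : ∀ {A : Set} {R : A → A → Set} {m x} {xs : Fin m → A} →
             (∀ y z → R y z → R z y) → (∀ i → R x (xs i)) → Pairwise R xs → Pairwise R (x Vector.∷ xs)
pairwise-∷ sym new old fzero    fzero    a≢b = contradiction refl a≢b
pairwise-∷ sym new old fzero    (fsuc b) _   = new b
pairwise-∷ sym new old (fsuc a) fzero    _   = sym _ _ (new a)
pairwise-∷ sym new old (fsuc a) (fsuc b) a≢b = old a b (a≢b ∘ cong fsuc)

Endpoint : ∀ {n} → Fin n × Fin n → Fin n → Set
Endpoint (u , v) x = x ≡ u ⊎ x ≡ v

SameEdge-sym : ∀ {n} {e e' : Fin n × Fin n} → SameEdge e e' → SameEdge e' e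
SameEdge-sym (inj₁ (p , q)) = inj₁ (sym p , sym q)
SameEdge-sym (inj₂ (p , q)) = inj₂ (sym q , sym p)

same-edge : ∀ {n} {e e' d : Fin n × Fin n} → e ≡ d → e' ≡ d → SameEdge e e'
same-edge refl refl = inj₁ (refl , refl)

reversed-edge : ∀ {n} {e e' : Fin n × Fin n} {u v} → e ≡ (u , v) → e' ≡ (v , u) → SameEdge e e'
reversed-edge refl refl = inj₂ (refl , refl)

SameEdge-endpoint : ∀ {n} {e e' : Fin n × Fin n} {x} → SameEdge e e' → Endpoint e' x → Endpoint e x
SameEdge-endpoint (inj₁ (refl , refl)) x∈e' = x∈e'
SameEdge-endpoint (inj₂ (refl , refl)) (inj₁ refl) = inj₂ refl
SameEdge-endpoint (inj₂ (refl , refl)) (inj₂ refl) = inj₁ refl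

module _ {n : ℕ} {G : Graph n} where
  open import Data.List.Membership.DecPropositional (Fin._≟_ {n}) using (_∈?_)

  adj-irreflexive : ∀ {u v} → Adj G u v → u ≢ v
  adj-irreflexive {u} uv refl = contradiction (trans (sym uv) (loopless G u)) λ ()

  Adj-sym : ∀ {u v} → Adj G u v → Adj G v u
  Adj-sym {u} {v} uv = trans (adj-sym G v u) uv

  EdgeDisjoint-sym : {C D : Cycle G} → EdgeDisjoint C D → EdgeDisjoint D C
  EdgeDisjoint-sym C∥D i i' same = C∥D i' i (SameEdge-sym same)

  shared-edge⇒same-cycle : ∀ {m} ((Cs , disjoint) : CyclePacking G m) {a b} i i' →
                           SameEdge (edge (Cs a) i) (edge (Cs b) i') → a ≡ b
  shared-edge⇒same-cycle (Cs , disjoint) {a} {b} i i' same with a Fin.≟ b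
  ... | yes a≡b = a≡b
  ... | no  a≢b = contradiction same (disjoint a b a≢b i i')

  restrict-packing : ∀ {k m} → k ≤ m → CyclePacking G m → CyclePacking G k
  restrict-packing k≤m (Cs , disjoint) =
    (λ i → Cs (inject≤ i k≤m)) , λ a b a≢b → disjoint _ _ (a≢b ∘ Fin.inject≤-injective k≤m k≤m a b)

  walk-crosses : ∀ (X : List (Fin n)) {s v} → Walk G s v → s ∈ X → v ∉ X →
                 ∃₂ λ a b → a ∈ X × b ∉ X × Adj G a b
  walk-crosses X []                       s∈X v∉X = contradiction s∈X v∉X
  walk-crosses X (_∷_ {v = w} sw walk) s∈X v∉X with w ∈? X
  ... | yes w∈X = walk-crosses X walk w∈X v∉X
  ... | no  w∉X = _ , w , s∈X , w∉X , sw

-- The apex fzero of K₁ ∇ T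

module _ {n : ℕ} (T : Graph n) where

  drop-apex : (C : Cycle (K1∇ T)) → (∀ i → fzero ≢ vert C i) → Cycle T
  drop-apex C avoids = record
    { j              = j C
    ; vert           = λ i → punchOut (avoids i)
    ; vert-injective = λ {i} {k} → vert-injective C ∘ Fin.punchOut-injective (avoids i) (avoids k)
    ; vert-adj       = λ i → subst₂ (Adj (K1∇ T)) (sym (Fin.punchIn-punchOut (avoids i)))
                                    (sym (Fin.punchIn-punchOut (avoids (next i)))) (vert-adj C i)
    }

  meets-apex : Acyclic T → (C : Cycle (K1∇ T)) → ∃ λ i → vert C i ≡ fzero
  meets-apex acyclic C = decidable-stable (Fin.any? λ i → vert C i Fin.≟ fzero)
    λ misses → acyclic (drop-apex C λ i e → misses (i , sym e))

  record ApexCorner (C : Cycle (K1∇ T)) : Set where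
    field
      enter leave  : Fin n
      enter≢leave  : enter ≢ leave
      enter-edge   : Fin (len C)
      leave-edge   : Fin (len C)
      enter-edge≡  : edge C enter-edge ≡ (fsuc enter , fzero)
      leave-edge≡  : edge C leave-edge ≡ (fzero , fsuc leave)

  apex-corner : Acyclic T → (C : Cycle (K1∇ T)) → ApexCorner C
  apex-corner acyclic C = record
    { enter       = punchOut avoid-prev
    ; leave       = punchOut avoid-next
    ; enter≢leave = λ e → next²≢id i (trans (cong next (sym (prev≡next e))) prev↦i)
    ; enter-edge  = prev
    ; leave-edge  = i
    ; enter-edge≡ = cong₂ _,_ (sym (Fin.punchIn-punchOut avoid-prev)) (trans (cong (vert C) prev↦i) i↦apex)
    ; leave-edge≡ = cong₂ _,_ i↦apex (sym (Fin.punchIn-punchOut avoid-next))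
    }
    where
      i : Fin (len C)
      i = proj₁ (meets-apex acyclic C)
      i↦apex : vert C i ≡ fzero
      i↦apex = proj₂ (meets-apex acyclic C)
      prev : Fin (len C)
      prev = proj₁ (next-surjective i)
      prev↦i : next prev ≡ i
      prev↦i = proj₂ (next-surjective i)

      at-apex : ∀ {k} → fzero ≡ vert C k → k ≡ i
      at-apex e = vert-injective C (trans (sym e) (sym i↦apex))

      avoid-prev : fzero ≢ vert C prev
      avoid-prev e = next≢id i (subst (λ k → next k ≡ i) (at-apex e) prev↦i)

      avoid-next : fzero ≢ vert C (next i)
      avoid-next e = next≢id i (at-apex e)

      prev≡next : punchOut avoid-prev ≡ punchOut avoid-next → prev ≡ next i
      prev≡next = vert-injective C ∘ Fin.punchOut-injective avoid-prev avoid-next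

  packing-bound : Acyclic T → ∀ {m} → CyclePacking (K1∇ T) m → m + m ≤ n
  packing-bound acyclic {m} packing@(Cs , _) =
    Fin.injective⇒≤ {f = corner-vertex ∘ splitAt m} (splitAt-injective m ∘ corner-vertex-injective _ _)
    where
      open ApexCorner
      corner : ∀ c → ApexCorner (Cs c)
      corner c = apex-corner acyclic (Cs c)

      corner-vertex : Fin m ⊎ Fin m → Fin n
      corner-vertex (inj₁ c) = enter (corner c)
      corner-vertex (inj₂ c) = leave (corner c)

      owner : ∀ {c c'} i i' → SameEdge (edge (Cs c) i) (edge (Cs c') i') → c ≡ c'
      owner = shared-edge⇒same-cycle packing

      shared-enter : ∀ {c c'} → enter (corner c) ≡ enter (corner c') → c ≡ c'
      shared-enter {c} {c'} e = owner _ _ (same-edge (enter-edge≡ (corner c))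
        (trans (enter-edge≡ (corner c')) (cong (λ x → fsuc x , fzero) (sym e))))

      shared-leave : ∀ {c c'} → leave (corner c) ≡ leave (corner c') → c ≡ c'
      shared-leave {c} {c'} e = owner _ _ (same-edge (leave-edge≡ (corner c))
        (trans (leave-edge≡ (corner c')) (cong (λ x → fzero , fsuc x) (sym e))))

      enter-meets-leave : ∀ {c c'} → enter (corner c) ≡ leave (corner c') → c ≡ c'
      enter-meets-leave {c} {c'} e = owner _ _ (reversed-edge (enter-edge≡ (corner c))
        (trans (leave-edge≡ (corner c')) (cong (λ x → fzero , fsuc x) (sym e))))

      corner-vertex-injective : ∀ s s' → corner-vertex s ≡ corner-vertex s' → s ≡ s'
      corner-vertex-injective (inj₁ c) (inj₁ c') e = cong inj₁ (shared-enter e)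
      corner-vertex-injective (inj₂ c) (inj₂ c') e = cong inj₂ (shared-leave e)
      corner-vertex-injective (inj₁ c) (inj₂ c') e with refl ← enter-meets-leave e =
        contradiction e (enter≢leave (corner c))
      corner-vertex-injective (inj₂ c) (inj₁ c') e with refl ← enter-meets-leave (sym e) =
        contradiction (sym e) (enter≢leave (corner c))

  -- Cones over short paths of T

  data ShortPath : Set where
    path₁ : (a b : Fin n) → Adj T a b → ShortPath
    path₂ : (a c b : Fin n) → Adj T a c → Adj T c b → a ≢ b → ShortPath

  End : ShortPath → Fin n → Set
  End (path₁ a b _)       x = x ≡ a ⊎ x ≡ b
  End (path₂ a _ b _ _ _) x = x ≡ a ⊎ x ≡ b

  Vertex : ShortPath → Fin n → Set
  Vertex P@(path₁ _ _ _)       x = End P x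
  Vertex P@(path₂ _ c _ _ _ _) x = End P x ⊎ x ≡ c

  end⇒vertex : ∀ P {x} → End P x → Vertex P x
  end⇒vertex (path₁ _ _ _)       e = e
  end⇒vertex (path₂ _ _ _ _ _ _) e = inj₁ e

  cone : ShortPath → Cycle (K1∇ T)
  cone (path₁ a b ab) = record
    { j = 0 ; vert = lookup vs ; vert-injective = λ {i} {k} → lookup-injective distinct i k ; vert-adj = around }
    where
      vs : Vec (Fin (suc n)) 3
      vs = fzero ∷ fsuc a ∷ fsuc b ∷ []
      distinct : Unique vs
      distinct = ((λ ()) ∷ (λ ()) ∷ []) ∷ ((adj-irreflexive {G = T} ab ∘ Fin.suc-injective) ∷ []) ∷ [] ∷ []
      around : ∀ i → Adj (K1∇ T) (lookup vs i) (lookup vs (next i))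
      around fzero                 = refl
      around (fsuc fzero)          = ab
      around (fsuc (fsuc fzero))   = refl
  cone (path₂ a c b ac cb a≢b) = record
    { j = 1 ; vert = lookup vs ; vert-injective = λ {i} {k} → lookup-injective distinct i k ; vert-adj = around }
    where
      vs : Vec (Fin (suc n)) 4
      vs = fzero ∷ fsuc a ∷ fsuc c ∷ fsuc b ∷ []
      distinct : Unique vs
      distinct =
        ((λ ()) ∷ (λ ()) ∷ (λ ()) ∷ []) ∷
        ((adj-irreflexive {G = T} ac ∘ Fin.suc-injective) ∷ (a≢b ∘ Fin.suc-injective) ∷ []) ∷
        ((adj-irreflexive {G = T} cb ∘ Fin.suc-injective) ∷ []) ∷ [] ∷ []
      around : ∀ i → Adj (K1∇ T) (lookup vs i) (lookup vs (next i))
      around fzero                      = refl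
      around (fsuc fzero)               = ac
      around (fsuc (fsuc fzero))        = cb
      around (fsuc (fsuc (fsuc fzero))) = refl

  data ConeEdge (P : ShortPath) : Fin (suc n) × Fin (suc n) → Set where
    spoke-out : ∀ {x} → End P x → ConeEdge P (fzero , fsuc x)
    spoke-in  : ∀ {x} → End P x → ConeEdge P (fsuc x , fzero)
    rim       : ∀ {x y} → Vertex P x → Vertex P y → End P x ⊎ End P y → ConeEdge P (fsuc x , fsuc y)

  cone-edge : ∀ P i → ConeEdge P (edge (cone P) i)
  cone-edge (path₁ _ _ _)       fzero                      = spoke-out (inj₁ refl)
  cone-edge (path₁ _ _ _)       (fsuc fzero)               = rim (inj₁ refl) (inj₂ refl) (inj₁ (inj₁ refl))
  cone-edge (path₁ _ _ _)       (fsuc (fsuc fzero))        = spoke-in (inj₂ refl)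
  cone-edge (path₂ _ _ _ _ _ _) fzero                      = spoke-out (inj₁ refl)
  cone-edge (path₂ _ _ _ _ _ _) (fsuc fzero)               = rim (inj₁ (inj₁ refl)) (inj₂ refl) (inj₁ (inj₁ refl))
  cone-edge (path₂ _ _ _ _ _ _) (fsuc (fsuc fzero))        = rim (inj₂ refl) (inj₁ (inj₂ refl)) (inj₂ (inj₂ refl))
  cone-edge (path₂ _ _ _ _ _ _) (fsuc (fsuc (fsuc fzero))) = spoke-in (inj₂ refl)

  cone-edge-end : ∀ {P e} → ConeEdge P e → ∃ λ y → End P y × Endpoint e (fsuc y)
  cone-edge-end (spoke-out y) = _ , y , inj₂ refl
  cone-edge-end (spoke-in y)  = _ , y , inj₁ refl
  cone-edge-end (rim _ _ (inj₁ x)) = _ , x , inj₁ refl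
  cone-edge-end (rim _ _ (inj₂ y)) = _ , y , inj₂ refl

  cone-edge-vertex : ∀ {P e x} → ConeEdge P e → Endpoint e (fsuc x) → Vertex P x
  cone-edge-vertex {P} (spoke-out y) (inj₂ refl) = end⇒vertex P y
  cone-edge-vertex {P} (spoke-in x)  (inj₁ refl) = end⇒vertex P x
  cone-edge-vertex (rim x _ _) (inj₁ refl) = x
  cone-edge-vertex (rim _ y _) (inj₂ refl) = y

  ConesDisjoint : ShortPath → ShortPath → Set
  ConesDisjoint P Q = EdgeDisjoint (cone P) (cone Q)

  ConesDisjoint-sym : ∀ P Q → ConesDisjoint P Q → ConesDisjoint Q P
  ConesDisjoint-sym P Q = EdgeDisjoint-sym {C = cone P} {D = cone Q}

  -- Every edge of cone Q has an end of Q among its endpoints, while every endpoint of an edge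
  -- of cone P other than the apex is a vertex of P.
  cones-disjoint : ∀ P Q → (∀ {x} → Vertex P x → ¬ End Q x) → ConesDisjoint P Q
  cones-disjoint P Q avoid i i' same with cone-edge-end (cone-edge Q i')
  ... | y , y-end , y∈e' = avoid (cone-edge-vertex (cone-edge P i) (SameEdge-endpoint same y∈e')) y-end

  -- Growth r U lists vertices newest first and ends with the root r; each other vertex is
  -- adjacent to a vertex p (its parent) occurring later in the list.

  data Growth (r : Fin n) : List (Fin n) → Set where
    root : Growth r [ r ]
    grow : ∀ {b U} (p : Fin n) → b ∉ U → p ∈ U → Adj T b p → Growth r U → Growth r (b ∷ U)

  root∈ : ∀ {r U} → Growth r U → r ∈ U
  root∈ root                 = here refl
  root∈ (grow _ _ _ _ growth) = there (root∈ growth)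

  module _ (connected : Connected T) (r : Fin n) where
    open import Data.List.Membership.DecPropositional (Fin._≟_ {n}) using (_∈?_; _∉?_)

    extend-growth : ∀ fuel {U} → Growth r U → n ≤ fuel + length U → ∃ λ U' → Growth r U' × n ≤ length U'
    extend-growth zero       growth bound = _ , growth , bound
    extend-growth (suc fuel) {U} growth bound with Fin.any? (_∉? U)
    ... | no  nothing-missing =
      U , growth , complete⇒≤length U λ v → decidable-stable (v ∈? U) (λ v∉U → nothing-missing (v , v∉U))
    ... | yes (v , v∉U) with walk-crosses U (connected r v) (root∈ growth) v∉U
    ...   | a , b , a∈U , b∉U , ab =
      extend-growth fuel (grow a b∉U a∈U (Adj-sym {G = T} ab) growth) (subst (n ≤_) (sym (+-suc fuel (length U))) bound)

    spanning-growth : ∃ λ U → Growth r U × n ≤ length U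
    spanning-growth = extend-growth n root (m≤m+n n 1)

  Link : Set
  Link = Fin n × Fin n

  Apart : Link → Link → Set
  Apart (c , p) (c' , p') = c ≢ c' × p ≢ p'

  Apart-sym : ∀ {l l'} → Apart l l' → Apart l' l
  Apart-sym (c≢c' , p≢p') = c≢c' ∘ sym , p≢p' ∘ sym

  Dangling : List (Fin n) → Link → Set
  Dangling U (c , p) = c ∉ U × p ∈ U × Adj T c p

  dangling-weaken : ∀ {b U c p} → Dangling (b ∷ U) (c , p) → p ≢ b → Dangling U (c , p)
  dangling-weaken (c∉ , here p≡b , cp) p≢b = contradiction p≡b p≢b
  dangling-weaken (c∉ , there p∈ , cp) _   = c∉ ∘ there , p∈ , cp

  Unused : ∀ {m} → (Fin m → ShortPath) → Fin n → Set
  Unused paths x = ∀ i → ¬ End (paths i) x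

  -- State of the greedy matching, which processes a growth order from the front (children first):
  -- U is the list of vertices not yet processed, and a waiting link (c , p) is a processed but
  -- unmatched vertex c together with its unprocessed parent p.
  record Greedy (N : ℕ) (U : List (Fin n)) : Set where
    field
      size          : ℕ
      paths         : Fin size → ShortPath
      disjoint      : Pairwise ConesDisjoint paths
      waiting       : List Link
      count         : size + size + length waiting + length U ≡ N
      ends-done     : ∀ i {x} → End (paths i) x → x ∉ U
      waiting-apart : AllPairs Apart waiting
      dangling      : All (Dangling U) waiting
      unused        : All (Unused paths ∘ proj₁) waiting
  open Greedy

  start : ∀ U → Greedy (length U) U
  start U = record
    { size = 0 ; paths = λ () ; disjoint = λ () ; waiting = [] ; count = refl
    ; ends-done = λ () ; waiting-apart = [] ; dangling = [] ; unused = [] }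

  module Picked {N U} (g : Greedy N U) {l rest} (σ : waiting g ↭ l ∷ rest) where
    dangling′ : All (Dangling U) (l ∷ rest)
    dangling′ = All-resp-↭ σ (dangling g)

    unused′ : All (Unused (paths g) ∘ proj₁) (l ∷ rest)
    unused′ = All-resp-↭ σ (unused g)

    apart′ : AllPairs Apart (l ∷ rest)
    apart′ = Permutationₛ.AllPairs-resp-↭ (setoid Link) Apart-sym (resp₂ Apart) (↭⇒↭ₛ σ) (waiting-apart g)

  add-path : ∀ {N b U} (g : Greedy N (b ∷ U)) {c t rest} → waiting g ↭ (c , t) ∷ rest → (P : ShortPath) →
             (∀ {x} → End P x → x ≡ c ⊎ x ≡ b) → (∀ {x} → Vertex P x → x ≡ c ⊎ x ∈ b ∷ U) →
             All (λ l → proj₂ l ≢ b) rest → b ∉ U → Greedy N U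
  add-path {N} {b} {U} g {c} {t} {rest} σ P ends vertices parents≢b b∉U = record
    { size          = suc (size g)
    ; paths         = P Vector.∷ paths g
    ; disjoint      = pairwise-∷ ConesDisjoint-sym (λ i → cones-disjoint P (paths g i) (fresh i)) (disjoint g)
    ; waiting       = rest
    ; count         = trans (count-shift (size g) (length rest) (length U))
                            (trans (cong (λ w → size g + size g + w + suc (length U)) (sym (↭-length σ))) (count g))
    ; ends-done     = ends-done′
    ; waiting-apart = AllPairs.tail apart′
    ; dangling      = All.tabulate λ l∈ → dangling-weaken (All.lookup (All.tail dangling′) l∈) (All.lookup parents≢b l∈)
    ; unused        = All.tabulate still-unused
    }
    where
      open Picked g σ

      count-shift : ∀ s w u → suc s + suc s + w + u ≡ s + s + suc w + suc u
      count-shift = solve-∀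

      fresh : ∀ i {x} → Vertex P x → ¬ End (paths g i) x
      fresh i v with vertices v
      ... | inj₁ refl = All.head unused′ i
      ... | inj₂ x∈   = λ e → ends-done g i e x∈

      ends-done′ : ∀ i {x} → End ((P Vector.∷ paths g) i) x → x ∉ U
      ends-done′ fzero e with ends e
      ... | inj₁ refl = proj₁ (All.head dangling′) ∘ there
      ... | inj₂ refl = b∉U
      ends-done′ (fsuc i) e = ends-done g i e ∘ there

      still-unused : ∀ {l} → l ∈ rest → Unused (P Vector.∷ paths g) (proj₁ l)
      still-unused l∈ fzero e with ends e
      ... | inj₁ c′≡c = proj₁ (All.lookup (AllPairs.head apart′) l∈) (sym c′≡c)
      ... | inj₂ refl = proj₁ (All.lookup (All.tail dangling′) l∈) (here refl)
      still-unused l∈ (fsuc i) = All.lookup (All.tail unused′) l∈ i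

  close-edge : ∀ {N b U} (g : Greedy N (b ∷ U)) {c rest} → waiting g ↭ (c , b) ∷ rest → b ∉ U → Greedy N U
  close-edge {b = b} g {c} σ b∉U =
    add-path g σ (path₁ c b cb) (λ e → e) (map₂ here) (All.map (λ apart → proj₂ apart ∘ sym) (AllPairs.head apart′)) b∉U
    where
      open Picked g σ
      cb : Adj T c b
      cb = proj₂ (proj₂ (All.head dangling′))

  close-path : ∀ {N b U} (g : Greedy N (b ∷ U)) {c p rest} → waiting g ↭ (c , p) ∷ rest → p ∈ U → Adj T b p →
               All (λ l → proj₂ l ≢ b) (waiting g) → b ∉ U → Greedy N U
  close-path {b = b} {U} g {c} {p} σ p∈U bp parents≢b b∉U =
    add-path g σ (path₂ c p b cp (Adj-sym {G = T} bp) c≢b) (λ e → e) vertices (All.tail (All-resp-↭ σ parents≢b)) b∉U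
    where
      open Picked g σ
      cp : Adj T c p
      cp = proj₂ (proj₂ (All.head dangling′))
      c≢b : c ≢ b
      c≢b c≡b = proj₁ (All.head dangling′) (here c≡b)
      vertices : ∀ {x} → End (path₂ c p b cp (Adj-sym {G = T} bp) c≢b) x ⊎ x ≡ p → x ≡ c ⊎ x ∈ b ∷ U
      vertices (inj₁ end)  = map₂ here end
      vertices (inj₂ refl) = inj₂ (there p∈U)

  wait : ∀ {N b U} (g : Greedy N (b ∷ U)) (p : Fin n) → b ∉ U → p ∈ U → Adj T b p →
         All (λ l → proj₂ l ≢ b) (waiting g) → All (λ l → proj₂ l ≢ p) (waiting g) → Greedy N U
  wait {b = b} {U} g p b∉U p∈U bp parents≢b parents≢p = record
    { size          = size g
    ; paths         = paths g
    ; disjoint      = disjoint g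
    ; waiting       = (b , p) ∷ waiting g
    ; count         = trans (count-shift (size g) (length (waiting g)) (length U)) (count g)
    ; ends-done     = λ i e → ends-done g i e ∘ there
    ; waiting-apart = All.tabulate apart-from-new ∷ waiting-apart g
    ; dangling      = (b∉U , p∈U , bp) ∷ All.tabulate λ l∈ →
                        dangling-weaken (All.lookup (dangling g) l∈) (All.lookup parents≢b l∈)
    ; unused        = (λ i e → ends-done g i e (here refl)) ∷ unused g
    }
    where
      count-shift : ∀ s w u → s + s + suc w + u ≡ s + s + w + suc u
      count-shift = solve-∀

      apart-from-new : ∀ {l} → l ∈ waiting g → Apart (b , p) l
      apart-from-new l∈ = (λ b≡c → proj₁ (All.lookup (dangling g) l∈) (here (sym b≡c)))
                        , (λ p≡q → All.lookup parents≢p l∈ (sym p≡q))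

  step : ∀ {N b U} (p : Fin n) → b ∉ U → p ∈ U → Adj T b p → Greedy N (b ∷ U) → Greedy N U
  step {b = b} p b∉U p∈U bp g with pick (λ l → proj₂ l Fin.≟ b) (waiting g)
  ... | inj₂ (_ , _ , refl , σ) = close-edge g σ b∉U
  ... | inj₁ none-at-b with pick (λ l → proj₂ l Fin.≟ p) (waiting g)
  ...   | inj₂ (_ , _ , refl , σ) = close-path g σ p∈U bp none-at-b b∉U
  ...   | inj₁ none-at-p          = wait g p b∉U p∈U bp none-at-b none-at-p

  run : ∀ {r N U} → Growth r U → Greedy N U → Greedy N [ r ]
  run root                          g = g
  run (grow p b∉U p∈U bp growth) g = run growth (step p b∉U p∈U bp g)

  nothing-dangles : ∀ {ws} → All (Dangling []) ws → ws ≡ []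
  nothing-dangles []                = refl
  nothing-dangles ((_ , () , _) ∷ _)

  size-bound : ∀ {N U} (g : Greedy N U) → waiting g ≡ [] → N ≡ size g + size g + length U
  size-bound {N} {U} g settled = begin
    N                                                 ≡⟨ sym (count g) ⟩
    size g + size g + length (waiting g) + length U   ≡⟨ cong (λ w → size g + size g + length w + length U) settled ⟩
    size g + size g + 0 + length U                    ≡⟨ cong (_+ length U) (+-identityʳ (size g + size g)) ⟩
    size g + size g + length U                        ∎
    where open ≡-Reasoning

  packing : ∀ {N U} (g : Greedy N U) → CyclePacking (K1∇ T) (size g)
  packing g = cone ∘ paths g , disjoint g

  finish : ∀ {N r} → Greedy N [ r ] → ∃ λ k → CyclePacking (K1∇ T) k × N ≤ suc (k + k)
  finish {N} {r} g with pick (λ l → proj₂ l Fin.≟ r) (waiting g)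
  ... | inj₁ none-at-r = size g , packing g , ≤-reflexive (trans (size-bound g settled) (+-comm _ 1))
    where
      settled : waiting g ≡ []
      settled = nothing-dangles (All.zipWith (uncurry dangling-weaken) (dangling g , none-at-r))
  ... | inj₂ (_ , _ , refl , σ) = size g′ , packing g′ , ≤-trans (≤-reflexive N≡) (n≤1+n _)
    where
      g′ : Greedy N []
      g′ = close-edge g σ λ ()
      N≡ : N ≡ size g′ + size g′
      N≡ = trans (size-bound g′ (nothing-dangles (dangling g′))) (+-identityʳ _)

  lower-bound : Connected T → Fin n → ∃ λ k → CyclePacking (K1∇ T) k × n ≤ suc (k + k)
  lower-bound connected r with spanning-growth connected r
  ... | U , growth , n≤|U| with finish (run growth (start U))
  ...   | k , packing , |U|≤ = k , packing , ≤-trans n≤|U| |U|≤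

m+m≡m*2 : ∀ m → m + m ≡ m * 2
m+m≡m*2 m = trans (cong (m +_) (sym (+-identityʳ m))) (*-comm 2 m)

m+m≤n⇒m≤n/2 : ∀ {m n} → m + m ≤ n → m ≤ n / 2
m+m≤n⇒m≤n/2 {m} {n} m+m≤n = begin
  m            ≡⟨ sym (m*n/n≡m m 2) ⟩
  m * 2 / 2    ≡⟨ cong (_/ 2) (sym (m+m≡m*2 m)) ⟩
  (m + m) / 2  ≤⟨ /-monoˡ-≤ 2 m+m≤n ⟩
  n / 2        ∎
  where open ≤-Reasoning

n≤1+m+m⇒n/2≤m : ∀ {m n} → n ≤ suc (m + m) → n / 2 ≤ m
n≤1+m+m⇒n/2≤m {m} {n} n≤1+m+m = s≤s⁻¹ (m<n*o⇒m/o<n (s≤s (≤-trans n≤1+m+m (≤-reflexive (cong suc (m+m≡m*2 m))))))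

half-packing : ∀ {n} (T : Graph n) → Connected T → CyclePacking (K1∇ T) (n / 2)
half-packing {zero}  T _         = (λ ()) , λ ()
half-packing {suc n} T connected with lower-bound T connected fzero
... | k , packing , bound = restrict-packing (n≤1+m+m⇒n/2≤m bound) packing

corollary2p1 : ∀ (n : ℕ) (T : Graph n) → IsTree T → IsMaxCyclePackingNumber (K1∇ T) (n / 2)
corollary2p1 n T (connected , acyclic) =
  half-packing T connected , λ m packing → m+m≤n⇒m≤n/2 (packing-bound T acyclic packing)
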